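{- Let $\mathcal{Q}$ be a finite poset and $\mathcal{A}$ a $\mathcal{Q}$-associative algebra. Then: (i) for every $x\in\mathcal{A}$, the set $\mathcal{E}_\mathcal{A}(x)$ is an order filter of $\mathcal{Q}$; (ii) for all $x,y\in\mathcal{A}$ with $x\neq y$, the sets $\mathcal{E}_\mathcal{A}(x)$ and $\mathcal{E}_\mathcal{A}(y)$ are disjoint.
   Context: A $\mathcal{Q}$-associative algebra is a vector space $\mathcal{A}$ over a field of characteristic zero endowed with bilinear operations $\star_a:\mathcal{A}\otimes\mathcal{A}\to\mathcal{A}$, $a\in\mathcal{Q}$, such that for all $x,y,z\in\mathcal{A}$ and all $a,b,c\in\mathcal{Q}$ with $a\preccurlyeq_\mathcal{Q} b$ and $a\preccurlyeq_\mathcal{Q} c$: $(x\star_a y)\star_b z=x\star_a(y\star_b z)=(x\star_c y)\star_a z=x\star_c(y\star_a z)$. For $a\in\mathcal{Q}$, an $a$-unit of $\mathcal{A}$ is an element $u$ with $u\star_a x=x=x\star_a u$ for all $x\in\mathcal{A}$. For $x\in\mathcal{A}$, $\mathcal{E}_\mathcal{A}(x)$ is the set of $a\in\mathcal{Q}$ such that $x$ is an $a$-unit. An order filter of $\mathcal{Q}$ is a subset $F$ such that $a\in F$ and $a\preccurlyeq_\mathcal{Q} b$ imply $b\in F$. -}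

module Defs where

open import Level using (Level; _⊔_; suc)
open import Data.Nat using (ℕ; zero) renaming (suc to sucℕ)
open import Data.Fin using (Fin)
open import Data.Product using (Σ; ∃; _×_; _,_)
open import Relation.Nullary using (¬_)
open import Relation.Binary.Bundles using (Poset)
open import Algebra.Bundles using (CommutativeRing)
open import Algebra.Module.Bundles using (Module)

module _ {c ℓ : Level} (K : CommutativeRing c ℓ) where
  open CommutativeRing K

  natToRing : ℕ → Carrier
  natToRing zero     = 0#
  natToRing (sucℕ n) = 1# + natToRing n

  IsField : Set (c ⊔ ℓ)
  IsField = (¬ (1# ≈ 0#))
          × (∀ x → ¬ (x ≈ 0#) → Σ Carrier λ y → (x * y) ≈ 1#)

  CharacteristicZero : Set ℓ
  CharacteristicZero = ∀ n → ¬ (natToRing (sucℕ n) ≈ 0#)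

IsFinitePoset : ∀ {c ℓ₁ ℓ₂} → Poset c ℓ₁ ℓ₂ → Set (c ⊔ ℓ₁)
IsFinitePoset Q = Σ ℕ λ n → Σ (Fin n → Carrier) λ f → ∀ q → ∃ λ i → f i ≈ q
  where open Poset Q

record QAssociativeAlgebra {c ℓ m ℓm q ℓq₁ ℓq₂ : Level}
       (K : CommutativeRing c ℓ) (Q : Poset q ℓq₁ ℓq₂)
       : Set (c ⊔ ℓ ⊔ suc (m ⊔ ℓm) ⊔ q ⊔ ℓq₂) where
  open CommutativeRing K using (Carrier)
  open Poset Q using () renaming (Carrier to Qc; _≤_ to _≼_)
  field
    vectorSpace : Module K m ℓm
  open Module vectorSpace public
  field
    ⋆ : Qc → Carrierᴹ → Carrierᴹ → Carrierᴹ
    ⋆-cong : ∀ a {x x′ y y′} → x ≈ᴹ x′ → y ≈ᴹ y′ → ⋆ a x y ≈ᴹ ⋆ a x′ y′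
    ⋆-+ˡ : ∀ a x x′ y → ⋆ a (x +ᴹ x′) y ≈ᴹ (⋆ a x y +ᴹ ⋆ a x′ y)
    ⋆-+ʳ : ∀ a x y y′ → ⋆ a x (y +ᴹ y′) ≈ᴹ (⋆ a x y +ᴹ ⋆ a x y′)
    ⋆-*ˡ : ∀ a (k : Carrier) x y → ⋆ a (k *ₗ x) y ≈ᴹ (k *ₗ ⋆ a x y)
    ⋆-*ʳ : ∀ a (k : Carrier) x y → ⋆ a x (k *ₗ y) ≈ᴹ (k *ₗ ⋆ a x y)
    Q-assoc₁ : ∀ {a b c} → a ≼ b → a ≼ c → ∀ x y z →
               ⋆ b (⋆ a x y) z ≈ᴹ ⋆ a x (⋆ b y z)
    Q-assoc₂ : ∀ {a b c} → a ≼ b → a ≼ c → ∀ x y z →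
               ⋆ a x (⋆ b y z) ≈ᴹ ⋆ a (⋆ c x y) z
    Q-assoc₃ : ∀ {a b c} → a ≼ b → a ≼ c → ∀ x y z →
               ⋆ a (⋆ c x y) z ≈ᴹ ⋆ c x (⋆ a y z)

  IsUnit : Qc → Carrierᴹ → Set (m ⊔ ℓm)
  IsUnit a u = ∀ x → (⋆ a u x ≈ᴹ x) × (⋆ a x u ≈ᴹ x)

  E : Carrierᴹ → Qc → Set (m ⊔ ℓm)
  E x a = IsUnit a x

IsOrderFilter : ∀ {q ℓ₁ ℓ₂ p} (Q : Poset q ℓ₁ ℓ₂) → (Poset.Carrier Q → Set p)
              → Set (q ⊔ ℓ₂ ⊔ p)
IsOrderFilter Q F = ∀ {a b} → F a → a ≤ b → F b
  where open Poset Q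

module Submission where

open import Defs
open import Level using (Level)
open import Data.Product using (_×_; _,_; proj₁; proj₂)
open import Relation.Nullary using (¬_)
open import Relation.Binary.Bundles using (Poset)
open import Algebra.Bundles using (CommutativeRing)
import Relation.Binary.Reasoning.Setoid as SetoidReasoning

-- An a-unit u is idempotent for every ⋆b with a ≼ b, and this idempotence
-- lets Q-associativity trade ⋆b against ⋆a on either side of u.

module _ {c ℓ m ℓm q ℓq₁ ℓq₂ : Level}
         {K : CommutativeRing c ℓ} {Q : Poset q ℓq₁ ℓq₂}
         (A : QAssociativeAlgebra {m = m} {ℓm = ℓm} K Q) where

  open QAssociativeAlgebra A
  open Poset Q using () renaming (_≤_ to _≼_; refl to ≼-refl)
  open SetoidReasoning ≈ᴹ-setoid

  unit-idempotent : ∀ {a b u} → IsUnit a u → a ≼ b → ⋆ b u u ≈ᴹ u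
  unit-idempotent {a} {b} {u} u-unit a≼b = begin
    ⋆ b u u           ≈⟨ proj₂ (u-unit _) ⟨
    ⋆ a (⋆ b u u) u   ≈⟨ Q-assoc₂ ≼-refl a≼b u u u ⟨
    ⋆ a u (⋆ a u u)   ≈⟨ proj₁ (u-unit _) ⟩
    ⋆ a u u           ≈⟨ proj₁ (u-unit u) ⟩
    u                 ∎

  unit-upward : ∀ {a b u} → IsUnit a u → a ≼ b → IsUnit b u
  unit-upward {a} {b} {u} u-unit a≼b x = left , right
    where
    left : ⋆ b u x ≈ᴹ x
    left = begin
      ⋆ b u x           ≈⟨ ⋆-cong b ≈ᴹ-refl (proj₁ (u-unit x)) ⟨
      ⋆ b u (⋆ a u x)   ≈⟨ Q-assoc₃ ≼-refl a≼b u u x ⟨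
      ⋆ a (⋆ b u u) x   ≈⟨ ⋆-cong a (unit-idempotent u-unit a≼b) ≈ᴹ-refl ⟩
      ⋆ a u x           ≈⟨ proj₁ (u-unit x) ⟩
      x                 ∎

    right : ⋆ b x u ≈ᴹ x
    right = begin
      ⋆ b x u           ≈⟨ ⋆-cong b (proj₂ (u-unit x)) ≈ᴹ-refl ⟨
      ⋆ b (⋆ a x u) u   ≈⟨ Q-assoc₁ a≼b ≼-refl x u u ⟩
      ⋆ a x (⋆ b u u)   ≈⟨ ⋆-cong a ≈ᴹ-refl (unit-idempotent u-unit a≼b) ⟩
      ⋆ a x u           ≈⟨ proj₂ (u-unit x) ⟩
      x                 ∎

  unit-unique : ∀ {a u v} → IsUnit a u → IsUnit a v → u ≈ᴹ v
  unit-unique {a} {u} {v} u-unit v-unit = begin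
    u         ≈⟨ proj₂ (v-unit u) ⟨
    ⋆ a u v   ≈⟨ proj₁ (u-unit v) ⟩
    v         ∎

proposition2p7 : ∀ {c ℓ m ℓm q ℓq₁ ℓq₂ : Level}
    (K : CommutativeRing c ℓ) → IsField K → CharacteristicZero K →
    (Q : Poset q ℓq₁ ℓq₂) → IsFinitePoset Q →
    (A : QAssociativeAlgebra {m = m} {ℓm = ℓm} K Q) →
    (∀ x → IsOrderFilter Q (QAssociativeAlgebra.E A x))
    × (∀ x y → ¬ (QAssociativeAlgebra._≈ᴹ_ A x y) →
    ∀ a → ¬ (QAssociativeAlgebra.E A x a × QAssociativeAlgebra.E A y a))
proposition2p7 K _ _ Q _ A =
    (λ x → unit-upward A)
  , (λ x y x≉y a (x-unit , y-unit) → x≉y (unit-unique A x-unit y-unit))
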